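{- Let $q$ be a prime power, $t,r$ positive integers, $n=2t$, and let $U_1,\ldots,U_r$ be $\mathbb{F}_q$-subspaces of $\mathbb{F}_{q^n}$ of dimension $t$. Let $U=U_1\times\cdots\times U_r$. If $\{U_1,\ldots,U_r\}$ is a multi-Sidon space, then $L_U$ is an $\mathbb{F}_q$-linear set of rank $rt$ in $\mathrm{PG}(r-1,q^n)$ such that the only points of weight greater than one are the points $P_i=\langle\mathbf{e}_i\rangle_{\mathbb{F}_{q^n}}$, $i\in\{1,\ldots,r\}$.
   Context: $\mathbf{e}_i$ is the $i$-th standard basis vector of $\mathbb{F}_{q^n}^r$. For an $\mathbb{F}_q$-subspace $W$ of $\mathbb{F}_{q^n}^r$, $L_W=\{\langle\mathbf{w}\rangle_{\mathbb{F}_{q^n}}:\mathbf{w}\in W\setminus\{\mathbf{0}\}\}$ has rank $\dim_{\mathbb{F}_q}W$, and $w_{L_W}(\langle\mathbf{v}\rangle_{\mathbb{F}_{q^n}})=\dim_{\mathbb{F}_q}(W\cap\langle\mathbf{v}\rangle_{\mathbb{F}_{q^n}})$. $\mathrm{Orb}(U)=\{\alpha U:\alpha\in\mathbb{F}_{q^n}^*\}$. A set $\{U_1,\ldots,U_r\}$ of $\mathbb{F}_q$-subspaces of $\mathbb{F}_{q^n}$ is a multi-Sidon space if: $\mathrm{Orb}(U_i)\cap\mathrm{Orb}(U_j)=\emptyset$ for $i\neq j$; $\dim_{\mathbb{F}_q}(U_i)\geq 2$ and $|\mathrm{Orb}(U_i)|=\frac{q^n-1}{q-1}$ for all $i$;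 and $\dim_{\mathbb{F}_q}(U_i\cap\alpha U_j)\leq 1$ for every $\alpha\in\mathbb{F}_{q^n}$ and all $i,j$ with $U_i\neq\alpha U_j$. -}

module Defs where

open import Level using (0ℓ)
open import Data.Nat as ℕ using (ℕ; zero; suc; _≤_; _<_)
open import Data.Fin using (Fin; zero; suc; _≟_)
open import Relation.Nullary using (yes; no)
open import Data.Product using (Σ; ∃; _×_; _,_)
open import Function.Bundles using (_⇔_)
open import Relation.Nullary using (¬_)
open import Relation.Binary.PropositionalEquality using (_≡_; _≢_)
open import Algebra.Structures using (IsCommutativeRing)

record Field : Set₁ where
  infixl 7 _*_
  infixl 6 _+_
  field
    Carrier : Set
    _+_ _*_ : Carrier → Carrier → Carrier
    -_      : Carrier → Carrier
    0# 1#   : Carrier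
    isCommutativeRing : IsCommutativeRing _≡_ _+_ _*_ -_ 0# 1#
    0≢1     : 0# ≢ 1#
    inverse : ∀ x → x ≢ 0# → ∃ λ y → x * y ≡ 1#

record FiniteSubfield (K : Field) (q : ℕ) : Set where
  open Field K
  field
    ι        : Fin q → Carrier
    ι-inj    : ∀ i j → ι i ≡ ι j → i ≡ j
  In : Carrier → Set
  In x = ∃ λ i → ι i ≡ x
  field
    0∈  : In 0#
    1∈  : In 1#
    +∈  : ∀ {x y} → In x → In y → In (x + y)
    *∈  : ∀ {x y} → In x → In y → In (x * y)
    -∈  : ∀ {x} → In x → In (- x)
    ⁻¹∈ : ∀ {x y} → In x → x * y ≡ 1# → In y

-- Generic notions for an F_q-vector space V (an abelian group with a
-- K-scalar multiplication, restricted to scalars in F_q).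

module LinearAlgebra (K : Field) {q : ℕ} (F : FiniteSubfield K q)
  (V : Set) (_≈_ : V → V → Set) (_⊕_ : V → V → V) (0v : V)
  (_·_ : Field.Carrier K → V → V) where
  open Field K
  open FiniteSubfield F using (In)

  Subset : Set₁
  Subset = V → Set

  lincomb : ∀ {d} → (Fin d → Carrier) → (Fin d → V) → V
  lincomb {zero}  a b = 0v
  lincomb {suc d} a b = (a zero · b zero) ⊕ lincomb (λ i → a (suc i)) (λ i → b (suc i))

  record IsSubspace (W : Subset) : Set where
    field
      resp : ∀ {x y} → x ≈ y → W x → W y
      0∈   : W 0v
      ⊕∈   : ∀ {x y} → W x → W y → W (x ⊕ y)
      ·∈   : ∀ {a x} → In a → W x → W (a · x)

  record IsBasis (W : Subset) (d : ℕ) (b : Fin d → V) : Set where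
    field
      inW    : ∀ i → W (b i)
      spans  : ∀ w → W w → ∃ λ (a : Fin d → Carrier) → (∀ i → In (a i)) × (w ≈ lincomb a b)
      indep  : ∀ (a : Fin d → Carrier) → (∀ i → In (a i)) → lincomb a b ≈ 0v → ∀ i → a i ≡ 0#

  HasDim : Subset → ℕ → Set
  HasDim W d = ∃ λ (b : Fin d → V) → IsBasis W d b

  DimAtMost : Subset → ℕ → Set
  DimAtMost W k = ∀ d → HasDim W d → d ≤ k

  _∩_ : Subset → Subset → Subset
  (A ∩ B) x = A x × B x

module Setting (K : Field) {q : ℕ} (F : FiniteSubfield K q) where
  open Field K public

  module LK = LinearAlgebra K F Carrier _≡_ _+_ 0# _*_

  Vec : ℕ → Set
  Vec r = Fin r → Carrier

  _≈v_ : ∀ {r} → Vec r → Vec r → Set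
  v ≈v w = ∀ i → v i ≡ w i

  module LV (r : ℕ) = LinearAlgebra K F (Vec r) _≈v_
    (λ v w i → v i + w i) (λ _ → 0#) (λ a v i → a * v i)

  SubsetK : Set₁
  SubsetK = Carrier → Set

  _∙S_ : Carrier → SubsetK → SubsetK
  (α ∙S U) x = ∃ λ u → U u × x ≡ α * u

  _≐_ : SubsetK → SubsetK → Set
  A ≐ B = ∀ x → (A x → B x) × (B x → A x)

  -- |Orb(U)| = m, where Orb(U) = { α U : α ∈ K* }:
  -- there are m nonzero α_1..α_m with pairwise distinct α_k U and every
  -- α U (α ≠ 0) equal to some α_k U.
  OrbSize : SubsetK → ℕ → Set
  OrbSize U m = ∃ λ (α : Fin m → Carrier) →
      (∀ k → α k ≢ 0#)
    × (∀ k l → (α k ∙S U) ≐ (α l ∙S U) → k ≡ l)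
    × (∀ β → β ≢ 0# → ∃ λ k → (β ∙S U) ≐ (α k ∙S U))

  record IsMultiSidon (r : ℕ) (n : ℕ) (U : Fin r → SubsetK) : Set where
    field
      subspace  : ∀ i → LK.IsSubspace (U i)
      orbDisj   : ∀ i j → i ≢ j → ∀ α β → α ≢ 0# → β ≢ 0# → ¬ ((α ∙S U i) ≐ (β ∙S U j))
      dim≥2     : ∀ i → ∃ λ d → LK.HasDim (U i) d × 2 ≤ d
      orbSize   : ∀ i → ∃ λ m → OrbSize (U i) m × m ℕ.* (q ℕ.∸ 1) ≡ q ℕ.^ n ℕ.∸ 1
      sidon     : ∀ α i j → ¬ (U i ≐ (α ∙S U j)) → LK.DimAtMost (U i LK.∩ (α ∙S U j)) 1

  prodSub : ∀ {r} → (Fin r → SubsetK) → LV.Subset r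
  prodSub U v = ∀ i → U i (v i)

  span : ∀ {r} → Vec r → LV.Subset r
  span v w = ∃ λ λ' → w ≈v (λ i → λ' * v i)

  HasWeight : ∀ {r} → LV.Subset r → Vec r → ℕ → Set
  HasWeight {r} W v d = LV.HasDim r (LV._∩_ r W (span v)) d

  e : ∀ {r} → Fin r → Vec r
  e i j with i ≟ j
  ... | yes _ = 1#
  ... | no  _ = 0#

  SamePoint : ∀ {r} → Vec r → Vec r → Set
  SamePoint v w = ∀ u → (span v u → span w u) × (span w u → span v u)

  NonZeroVec : ∀ {r} → Vec r → Set
  NonZeroVec v = ¬ (∀ i → v i ≡ 0#)

-- The weight of ⟨v⟩ is the F_q-dimension of the space of vectors λv lying in
-- U₁ × ⋯ × Uᵣ.  If only the i-th coordinate of v is nonzero this space is Uᵢ eᵢ,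
-- of dimension dim Uᵢ ≥ 2.  If vᵢ and vⱼ are both nonzero for some i ≠ j,
-- projecting to the i-th coordinate embeds it into Uᵢ ∩ α Uⱼ with α = vᵢ / vⱼ,
-- and Uᵢ ≠ α Uⱼ because the orbits of Uᵢ and Uⱼ are disjoint; the Sidon
-- condition then bounds the weight by 1.

module Submission where

open import Defs
open import Data.Nat using (ℕ; _*_; _<_; _≤_)
open import Data.Fin using (Fin)
open import Data.Product using (∃; _×_)
open import Data.Unit using (⊤)
open import Relation.Binary.PropositionalEquality using (_≡_)
open import Function.Bundles using (_⇔_)
open Setting using (module LK; module LV; SubsetK; IsMultiSidon; prodSub; Vec; NonZeroVec; HasWeight; SamePoint; e)

open import Level using (0ℓ)
open import Algebra.Bundles using (CommutativeRing)
open import Data.Empty using (⊥-elim)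
open import Data.Fin as Fin using (zero; suc; _↑ˡ_; _↑ʳ_; splitAt; join)
open import Data.Fin.Properties using (join-splitAt; ¬∀⟶∃¬; all?; any?)
open import Data.List using (List; []; _∷_; [_]; allFin; cartesianProductWith)
open import Data.List.Membership.Propositional using (_∈_)
open import Data.List.Membership.Propositional.Properties
  using (∈-allFin; ∈-cartesianProductWith⁺; ∈-cartesianProductWith⁻)
open import Data.List.Relation.Unary.Any as Any using (here; there)
open import Data.Nat as ℕ using (zero; suc)
open import Data.Nat.Properties using (≤-refl; ≤-trans; m≤n⇒m≤1+n; <⇒≱)
open import Data.Product using (_,_; proj₁; proj₂)
open import Data.Sum using (inj₁; inj₂)
open import Data.Sum.Properties using ([,]-map; [,]-∘)
open import Data.Vec.Functional as Vector using (_++_)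
open import Data.Vec.Functional.Properties using (lookup-++ˡ; lookup-++ʳ)
open import Function using (_∘_; const)
open import Function.Bundles using (mk⇔)
open import Relation.Binary.Definitions using (DecidableEquality)
open import Relation.Binary.PropositionalEquality
  using (_≢_; refl; sym; trans; cong; cong₂; subst; module ≡-Reasoning)
open import Relation.Nullary using (¬_; Dec; yes; no; ¬?)
open import Relation.Nullary.Decidable using (map′; decidable-stable; _×-dec_)
open import Relation.Unary using (Decidable)
open ≡-Reasoning

module _ (K : Field) {q : ℕ} (F : FiniteSubfield K q) where
  open Setting K F
    hiding (module LK; module LV; SubsetK; IsMultiSidon; prodSub; Vec; NonZeroVec; HasWeight; SamePoint; e)
    renaming (_*_ to _·_)
  open FiniteSubfield F using (ι; ι-inj; In; 0∈; 1∈; -∈; *∈; ⁻¹∈)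
  open LK K F using (lincomb; IsSubspace; IsBasis; HasDim)

  commutativeRing : CommutativeRing 0ℓ 0ℓ
  commutativeRing = record { isCommutativeRing = isCommutativeRing }

  open CommutativeRing commutativeRing
    using ( +-assoc; +-identityˡ; +-identityʳ; -‿inverseʳ; *-assoc; *-comm; *-identityˡ; *-identityʳ
          ; distribˡ; distribʳ; zeroˡ; zeroʳ; ring )
  open import Algebra.Properties.Ring ring
    using (-‿distribˡ-*; -‿distribʳ-*; +-inverseˡ-unique; x∙y⁻¹≈ε⇒x≈y)

  1≢0 : 1# ≢ 0#
  1≢0 1≡0 = 0≢1 (sym 1≡0)

  x·y≡0⇒x≡0 : ∀ {x y} → y ≢ 0# → x · y ≡ 0# → x ≡ 0#
  x·y≡0⇒x≡0 {x} {y} y≢0 xy≡0 with inverse y y≢0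
  ... | y⁻¹ , yy⁻¹≡1 = begin
    x              ≡⟨ sym (*-identityʳ x) ⟩
    x · 1#         ≡⟨ cong (x ·_) (sym yy⁻¹≡1) ⟩
    x · (y · y⁻¹)  ≡⟨ sym (*-assoc x y y⁻¹) ⟩
    (x · y) · y⁻¹  ≡⟨ cong (_· y⁻¹) xy≡0 ⟩
    0# · y⁻¹       ≡⟨ zeroˡ y⁻¹ ⟩
    0#             ∎

  x≢0∧y≢0⇒x·y≢0 : ∀ {x y} → x ≢ 0# → y ≢ 0# → x · y ≢ 0#
  x≢0∧y≢0⇒x·y≢0 x≢0 y≢0 xy≡0 = x≢0 (x·y≡0⇒x≡0 y≢0 xy≡0)

  x·y≡1⇒y≢0 : ∀ {x y} → x · y ≡ 1# → y ≢ 0#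
  x·y≡1⇒y≢0 {x} xy≡1 y≡0 = 1≢0 (trans (sym xy≡1) (trans (cong (x ·_) y≡0) (zeroʳ x)))

  x·y≡1⇒x·[y·z]≡z : ∀ {x y} → x · y ≡ 1# → ∀ z → x · (y · z) ≡ z
  x·y≡1⇒x·[y·z]≡z {x} {y} xy≡1 z = begin
    x · (y · z)  ≡⟨ sym (*-assoc x y z) ⟩
    (x · y) · z  ≡⟨ cong (_· z) xy≡1 ⟩
    1# · z       ≡⟨ *-identityˡ z ⟩
    z            ∎

  In-≡0? : ∀ {x} → In x → Dec (x ≡ 0#)
  In-≡0? {x} (m , ιm≡x) with m Fin.≟ proj₁ 0∈
  ... | yes m≡0 = yes (trans (sym ιm≡x) (trans (cong ι m≡0) (proj₂ 0∈)))
  ... | no m≢0  = no λ x≡0 → m≢0 (ι-inj _ _ (trans ιm≡x (trans x≡0 (sym (proj₂ 0∈)))))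

  lincomb-termwise : ∀ {d} {a a′ b b′ : Fin d → Carrier} →
    (∀ s → a s · b s ≡ a′ s · b′ s) → lincomb a b ≡ lincomb a′ b′
  lincomb-termwise {zero}  eq = refl
  lincomb-termwise {suc d} eq = cong₂ _+_ (eq zero) (lincomb-termwise (eq ∘ suc))

  lincomb-zero : ∀ {d} {a b : Fin d → Carrier} → (∀ s → a s · b s ≡ 0#) → lincomb a b ≡ 0#
  lincomb-zero {zero}  eq = refl
  lincomb-zero {suc d} eq = trans (cong₂ _+_ (eq zero) (lincomb-zero (eq ∘ suc))) (+-identityˡ 0#)

  lincomb-*ˡ : ∀ {d} (c : Carrier) (a b : Fin d → Carrier) → lincomb (λ s → c · a s) b ≡ c · lincomb a b
  lincomb-*ˡ {zero}  c a b = sym (zeroʳ c)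
  lincomb-*ˡ {suc d} c a b = begin
    (c · a zero) · b zero + lincomb (λ s → c · a (suc s)) (b ∘ suc)
      ≡⟨ cong₂ _+_ (*-assoc c (a zero) (b zero)) (lincomb-*ˡ c (a ∘ suc) (b ∘ suc)) ⟩
    c · (a zero · b zero) + c · lincomb (a ∘ suc) (b ∘ suc)
      ≡⟨ sym (distribˡ c _ _) ⟩
    c · (a zero · b zero + lincomb (a ∘ suc) (b ∘ suc)) ∎

  lincomb-*ʳ : ∀ {d} (a b : Fin d → Carrier) (c : Carrier) → lincomb a (λ s → b s · c) ≡ lincomb a b · c
  lincomb-*ʳ {zero}  a b c = sym (zeroˡ c)
  lincomb-*ʳ {suc d} a b c = begin
    a zero · (b zero · c) + lincomb (a ∘ suc) (λ s → b (suc s) · c)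
      ≡⟨ cong₂ _+_ (sym (*-assoc (a zero) (b zero) c)) (lincomb-*ʳ (a ∘ suc) (b ∘ suc) c) ⟩
    (a zero · b zero) · c + lincomb (a ∘ suc) (b ∘ suc) · c
      ≡⟨ sym (distribʳ c _ _) ⟩
    (a zero · b zero + lincomb (a ∘ suc) (b ∘ suc)) · c ∎

  lincomb-++ : ∀ {t m} (a : Fin (t ℕ.+ m) → Carrier) (b : Fin t → Carrier) (b′ : Fin m → Carrier) →
    lincomb a (b ++ b′) ≡ lincomb (a ∘ (_↑ˡ m)) b + lincomb (a ∘ (t ↑ʳ_)) b′
  lincomb-++ {zero}      a b b′ = sym (+-identityˡ _)
  lincomb-++ {suc t} {m} a b b′ = begin
    a zero · b zero + lincomb (a ∘ suc) ((b ++ b′) ∘ suc)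
      ≡⟨ cong (a zero · b zero +_) (lincomb-termwise (λ k → cong (a (suc k) ·_) ([,]-map (splitAt t k)))) ⟩
    a zero · b zero + lincomb (a ∘ suc) ((b ∘ suc) ++ b′)
      ≡⟨ cong (a zero · b zero +_) (lincomb-++ (a ∘ suc) (b ∘ suc) b′) ⟩
    a zero · b zero + (lincomb (a ∘ suc ∘ (_↑ˡ m)) (b ∘ suc) + lincomb (a ∘ suc ∘ (t ↑ʳ_)) b′)
      ≡⟨ sym (+-assoc _ _ _) ⟩
    (a zero · b zero + lincomb (a ∘ suc ∘ (_↑ˡ m)) (b ∘ suc)) + lincomb (a ∘ suc ∘ (t ↑ʳ_)) b′ ∎

  lincomb∈ : ∀ {W} → IsSubspace W → ∀ {d} (a b : Fin d → Carrier) →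
    (∀ s → In (a s)) → (∀ s → W (b s)) → W (lincomb a b)
  lincomb∈ sub {zero}  a b a∈ b∈ = IsSubspace.0∈ sub
  lincomb∈ sub {suc d} a b a∈ b∈ =
    IsSubspace.⊕∈ sub (IsSubspace.·∈ sub (a∈ zero) (b∈ zero)) (lincomb∈ sub (a ∘ suc) (b ∘ suc) (a∈ ∘ suc) (b∈ ∘ suc))

  lincombᵛ-pointwise : ∀ {r d} (a : Fin d → Carrier) (B : Fin d → Vec K F r) j →
    LV.lincomb K F r a B j ≡ lincomb a (λ s → B s j)
  lincombᵛ-pointwise {d = zero}  a B j = refl
  lincombᵛ-pointwise {d = suc d} a B j = cong (a zero · B zero j +_) (lincombᵛ-pointwise (a ∘ suc) (B ∘ suc) j)

  InSpan : ∀ {k} → (Fin k → Carrier) → Carrier → Set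
  InSpan b x = ∃ λ a → (∀ s → In (a s)) × x ≡ lincomb a b

  Independent : ∀ {k} → (Fin k → Carrier) → Set
  Independent b = ∀ a → (∀ s → In (a s)) → lincomb a b ≡ 0# → ∀ s → a s ≡ 0#

  InSpan-∷-head : ∀ {k} x (c : Fin k → Carrier) → InSpan (x Vector.∷ c) x
  InSpan-∷-head x c = 1# Vector.∷ const 0# , (λ { zero → 1∈ ; (suc s) → 0∈ }) , sym (begin
    1# · x + lincomb (const 0#) c  ≡⟨ cong₂ _+_ (*-identityˡ x) (lincomb-zero (zeroˡ ∘ c)) ⟩
    x + 0#                         ≡⟨ +-identityʳ x ⟩
    x                              ∎)

  InSpan-∷⁺ : ∀ {k} x (c : Fin k → Carrier) {y} → InSpan c y → InSpan (x Vector.∷ c) y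
  InSpan-∷⁺ x c (a , a∈ , y≡) = 0# Vector.∷ a , (λ { zero → 0∈ ; (suc s) → a∈ s }) ,
    trans y≡ (sym (trans (cong (_+ lincomb a c) (zeroˡ x)) (+-identityˡ _)))

  Independent-∷ : ∀ {k} x (c : Fin k → Carrier) → Independent c → ¬ InSpan c x → Independent (x Vector.∷ c)
  Independent-∷ x c c-indep x∉c a a∈ a·xc≡0 = a≡0
    where
    L : Carrier
    L = lincomb (a ∘ suc) c
    a₀≡0 : a zero ≡ 0#
    a₀≡0 with In-≡0? (a∈ zero)
    ... | yes a₀≡0 = a₀≡0
    ... | no a₀≢0 with inverse (a zero) a₀≢0
    ...   | y , a₀y≡1 = ⊥-elim (x∉c ((λ s → - y · a (suc s)) , (λ s → *∈ (-∈ y∈) (a∈ (suc s))) , x≡))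
      where
      y∈ : In y
      y∈ = ⁻¹∈ (a∈ zero) a₀y≡1
      x≡ : x ≡ lincomb (λ s → - y · a (suc s)) c
      x≡ = begin
        x                ≡⟨ sym (x·y≡1⇒x·[y·z]≡z (trans (*-comm y (a zero)) a₀y≡1) x) ⟩
        y · (a zero · x) ≡⟨ cong (y ·_) (+-inverseˡ-unique (a zero · x) L a·xc≡0) ⟩
        y · - L          ≡⟨ sym (-‿distribʳ-* y L) ⟩
        - (y · L)        ≡⟨ -‿distribˡ-* y L ⟩
        - y · L          ≡⟨ sym (lincomb-*ˡ (- y) (a ∘ suc) c) ⟩
        lincomb (λ s → - y · a (suc s)) c ∎
    a≡0 : ∀ s → a s ≡ 0#
    a≡0 zero    = a₀≡0
    a≡0 (suc s) = c-indep (a ∘ suc) (a∈ ∘ suc)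
      (trans (sym (trans (cong (_+ L) (trans (cong (_· x) a₀≡0) (zeroˡ x))) (+-identityˡ L))) a·xc≡0) s

  combinations : ∀ {k} → (Fin k → Carrier) → List Carrier
  combinations {zero}  b = [ 0# ]
  combinations {suc k} b = cartesianProductWith (λ a y → ι a · b zero + y) (allFin q) (combinations (b ∘ suc))

  ∈-combinations⁺ : ∀ {k} (f : Fin k → Fin q) (b : Fin k → Carrier) → lincomb (ι ∘ f) b ∈ combinations b
  ∈-combinations⁺ {zero}  f b = here refl
  ∈-combinations⁺ {suc k} f b =
    ∈-cartesianProductWith⁺ (λ a y → ι a · b zero + y) (∈-allFin (f zero)) (∈-combinations⁺ (f ∘ suc) (b ∘ suc))

  ∈-combinations⁻ : ∀ {k} (b : Fin k → Carrier) {y} → y ∈ combinations b → ∃ λ f → y ≡ lincomb (ι ∘ f) b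
  ∈-combinations⁻ {zero}  b (here y≡0) = (λ ()) , y≡0
  ∈-combinations⁻ {suc k} b y∈
    with ∈-cartesianProductWith⁻ (λ a y → ι a · b zero + y) (allFin q) (combinations (b ∘ suc)) y∈
  ... | a , y′ , _ , y′∈ , y≡ with ∈-combinations⁻ (b ∘ suc) y′∈
  ...   | f , y′≡ = a Vector.∷ f , trans y≡ (cong (ι a · b zero +_) y′≡)

  InSpan⇒∈combinations : ∀ {k} (b : Fin k → Carrier) {x} → InSpan b x → x ∈ combinations b
  InSpan⇒∈combinations b (a , a∈ , x≡) =
    subst (_∈ combinations b)
      (sym (trans x≡ (lincomb-termwise (λ s → cong (_· b s) (sym (proj₂ (a∈ s)))))))
      (∈-combinations⁺ (proj₁ ∘ a∈) b)

  ∈combinations⇒InSpan : ∀ {k} (b : Fin k → Carrier) {x} → x ∈ combinations b → InSpan b x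
  ∈combinations⇒InSpan b x∈ with ∈-combinations⁻ b x∈
  ... | f , x≡ = ι ∘ f , (λ s → f s , refl) , x≡

  finiteDegree⇒decEq : ∀ {n} → HasDim (λ _ → ⊤) n → DecidableEquality Carrier
  finiteDegree⇒decEq (b , isB) x y = map′ (x∙y⁻¹≈ε⇒x≈y x y) (λ { refl → -‿inverseʳ x }) (≡0? (x + - y))
    where
    ≡0? : ∀ z → Dec (z ≡ 0#)
    ≡0? z with IsBasis.spans isB z _
    ... | a , a∈ , z≡ = map′ (λ a≡0 → trans z≡ (lincomb-zero (λ s → trans (cong (_· b s) (a≡0 s)) (zeroˡ (b s)))))
                             (λ z≡0 → IsBasis.indep isB a a∈ (trans (sym z≡) z≡0))
                             (all? (λ s → In-≡0? (a∈ s)))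

  module WithDecidableEquality (_≟_ : DecidableEquality Carrier) where

    InSpan? : ∀ {k} (b : Fin k → Carrier) → Decidable (InSpan b)
    InSpan? b x = map′ (∈combinations⇒InSpan b) (InSpan⇒∈combinations b) (Any.any? (x ≟_) (combinations b))

    subspace-decidable : ∀ {W d b} → IsSubspace W → IsBasis W d b → Decidable W
    subspace-decidable {b = b} sub isB x =
      map′ (λ { (a , a∈ , x≡) → subst _ (sym x≡) (lincomb∈ sub a b a∈ (IsBasis.inW isB)) })
           (IsBasis.spans isB x)
           (InSpan? b x)

    record IndependentIn (S : Carrier → Set) : Set where
      constructor independentIn
      field
        {size}      : ℕ
        family      : Fin size → Carrier
        family∈S    : ∀ s → S (family s)
        independent : Independent family
    open IndependentIn

    greedy : ∀ {S} → Decidable S → (xs : List Carrier) (c : IndependentIn S) →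
      ∃ λ (c′ : IndependentIn S) → size c ≤ size c′ × (∀ {x} → x ∈ xs → S x → InSpan (family c′) x)
    greedy S? [] c = c , ≤-refl , λ ()
    greedy S? (x ∷ xs) c with greedy S? xs c
    ... | c′ , c≤c′ , spans with InSpan? (family c′) x | S? x
    ...   | yes x∈c′ | _ = c′ , c≤c′ , λ { (here refl) _ → x∈c′ ; (there y∈) y∈S → spans y∈ y∈S }
    ...   | no x∉c′ | no x∉S = c′ , c≤c′ , λ { (here refl) x∈S → ⊥-elim (x∉S x∈S) ; (there y∈) y∈S → spans y∈ y∈S }
    ...   | no x∉c′ | yes x∈S =
      independentIn (x Vector.∷ family c′) (λ { zero → x∈S ; (suc s) → family∈S c′ s })
                    (Independent-∷ x (family c′) (independent c′) x∉c′) ,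
      m≤n⇒m≤1+n c≤c′ ,
      λ { (here refl) _ → InSpan-∷-head x (family c′) ; (there y∈) y∈S → InSpan-∷⁺ x (family c′) (spans y∈ y∈S) }

    -- The Sidon condition only bounds dimensions witnessed by a basis; this
    -- supplies one for Uᵢ ∩ α Uⱼ, large enough to contain a given independent family.
    extendToBasis : ∀ {S} → Decidable S → (xs : List Carrier) → (∀ {x} → S x → x ∈ xs) →
      ∀ {k} (c : Fin k → Carrier) → (∀ s → S (c s)) → Independent c → ∃ λ d → k ≤ d × HasDim S d
    extendToBasis S? xs S⊆xs c c∈S c-indep with greedy S? xs (independentIn c c∈S c-indep)
    ... | c′ , k≤d , spans =
      size c′ , k≤d , family c′ ,
      record { inW = family∈S c′ ; spans = λ x x∈S → spans (S⊆xs x∈S) x∈S ; indep = independent c′ }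

  ↑-cases : ∀ {t m} (P : Fin (t ℕ.+ m) → Set) → (∀ s → P (s ↑ˡ m)) → (∀ s → P (t ↑ʳ s)) → ∀ k → P k
  ↑-cases {t} {m} P left right k = subst P (join-splitAt t m k) (by-side (splitAt t k))
    where
    by-side : ∀ x → P (join t m x)
    by-side (inj₁ s) = left s
    by-side (inj₂ s) = right s

  module _ {t r d} {U : Fin (suc r) → SubsetK K F} (sub : ∀ i → IsSubspace (U i))
           {b : Fin t → Carrier} (isB : IsBasis (U zero) t b)
           {B : Fin d → Vec K F r} (isB′ : LV.IsBasis K F r (prodSub K F (U ∘ suc)) d B) where

    private
      C : Fin (t ℕ.+ d) → Vec K F (suc r)
      C = (λ s → b s Vector.∷ const 0#) ++ (λ m → 0# Vector.∷ B m)

      C-pointwise : ∀ k j → C k j ≡ ((λ s → (b s Vector.∷ const 0#) j) ++ (λ m → (0# Vector.∷ B m) j)) k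
      C-pointwise k j = [,]-∘ (λ v → v j) {λ s → b s Vector.∷ const 0#} {λ m → 0# Vector.∷ B m} (splitAt t k)

      C-head : ∀ A → LV.lincomb K F (suc r) A C zero ≡ lincomb (A ∘ (_↑ˡ d)) b
      C-head A = begin
        LV.lincomb K F (suc r) A C zero
          ≡⟨ lincombᵛ-pointwise A C zero ⟩
        lincomb A (λ k → C k zero)
          ≡⟨ lincomb-termwise (λ k → cong (A k ·_) (C-pointwise k zero)) ⟩
        lincomb A (b ++ const 0#)
          ≡⟨ lincomb-++ A b (const 0#) ⟩
        lincomb (A ∘ (_↑ˡ d)) b + lincomb (A ∘ (t ↑ʳ_)) (const 0#)
          ≡⟨ cong (lincomb (A ∘ (_↑ˡ d)) b +_) (lincomb-zero (λ m → zeroʳ (A (t ↑ʳ m)))) ⟩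
        lincomb (A ∘ (_↑ˡ d)) b + 0#
          ≡⟨ +-identityʳ _ ⟩
        lincomb (A ∘ (_↑ˡ d)) b ∎

      C-tail : ∀ A j → LV.lincomb K F (suc r) A C (suc j) ≡ LV.lincomb K F r (A ∘ (t ↑ʳ_)) B j
      C-tail A j = begin
        LV.lincomb K F (suc r) A C (suc j)
          ≡⟨ lincombᵛ-pointwise A C (suc j) ⟩
        lincomb A (λ k → C k (suc j))
          ≡⟨ lincomb-termwise (λ k → cong (A k ·_) (C-pointwise k (suc j))) ⟩
        lincomb A (const 0# ++ (λ m → B m j))
          ≡⟨ lincomb-++ A (const 0#) (λ m → B m j) ⟩
        lincomb (A ∘ (_↑ˡ d)) (const 0#) + lincomb (A ∘ (t ↑ʳ_)) (λ m → B m j)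
          ≡⟨ cong (_+ lincomb (A ∘ (t ↑ʳ_)) (λ m → B m j)) (lincomb-zero (λ s → zeroʳ (A (s ↑ˡ d)))) ⟩
        0# + lincomb (A ∘ (t ↑ʳ_)) (λ m → B m j)
          ≡⟨ +-identityˡ _ ⟩
        lincomb (A ∘ (t ↑ʳ_)) (λ m → B m j)
          ≡⟨ sym (lincombᵛ-pointwise (A ∘ (t ↑ʳ_)) B j) ⟩
        LV.lincomb K F r (A ∘ (t ↑ʳ_)) B j ∎

      C∈ : ∀ k → prodSub K F U (C k)
      C∈ k with splitAt t k
      ... | inj₁ s = λ { zero → IsBasis.inW isB s ; (suc i) → IsSubspace.0∈ (sub (suc i)) }
      ... | inj₂ m = λ { zero → IsSubspace.0∈ (sub zero) ; (suc i) → LV.IsBasis.inW isB′ m i }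

      C-spans : ∀ w → prodSub K F U w →
        ∃ λ A → (∀ k → In (A k)) × (∀ j → w j ≡ LV.lincomb K F (suc r) A C j)
      C-spans w w∈ with IsBasis.spans isB (w zero) (w∈ zero) | LV.IsBasis.spans isB′ (w ∘ suc) (w∈ ∘ suc)
      ... | a , a∈ , w₀≡ | A′ , A′∈ , w′≡ = A , A∈ , w≡
        where
        A : Fin (t ℕ.+ d) → Carrier
        A = a ++ A′
        A∈ : ∀ k → In (A k)
        A∈ = ↑-cases (In ∘ A) (λ s → subst In (sym (lookup-++ˡ a A′ s)) (a∈ s))
                              (λ m → subst In (sym (lookup-++ʳ a A′ m)) (A′∈ m))
        w≡ : ∀ j → w j ≡ LV.lincomb K F (suc r) A C j
        w≡ zero = begin
          w zero                    ≡⟨ w₀≡ ⟩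
          lincomb a b               ≡⟨ lincomb-termwise (λ s → cong (_· b s) (sym (lookup-++ˡ a A′ s))) ⟩
          lincomb (A ∘ (_↑ˡ d)) b   ≡⟨ sym (C-head A) ⟩
          LV.lincomb K F (suc r) A C zero ∎
        w≡ (suc j) = begin
          w (suc j)                             ≡⟨ w′≡ j ⟩
          LV.lincomb K F r A′ B j               ≡⟨ lincombᵛ-pointwise A′ B j ⟩
          lincomb A′ (λ m → B m j)              ≡⟨ lincomb-termwise (λ m → cong (_· B m j) (sym (lookup-++ʳ a A′ m))) ⟩
          lincomb (A ∘ (t ↑ʳ_)) (λ m → B m j)   ≡⟨ sym (lincombᵛ-pointwise (A ∘ (t ↑ʳ_)) B j) ⟩
          LV.lincomb K F r (A ∘ (t ↑ʳ_)) B j    ≡⟨ sym (C-tail A j) ⟩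
          LV.lincomb K F (suc r) A C (suc j) ∎

      C-indep : ∀ A → (∀ k → In (A k)) → (∀ j → LV.lincomb K F (suc r) A C j ≡ 0#) → ∀ k → A k ≡ 0#
      C-indep A A∈ AC≡0 = ↑-cases (λ k → A k ≡ 0#)
        (IsBasis.indep isB (A ∘ (_↑ˡ d)) (A∈ ∘ (_↑ˡ d)) (trans (sym (C-head A)) (AC≡0 zero)))
        (LV.IsBasis.indep isB′ (A ∘ (t ↑ʳ_)) (A∈ ∘ (t ↑ʳ_)) (λ j → trans (sym (C-tail A j)) (AC≡0 (suc j))))

    prodSub-suc-HasDim : LV.HasDim K F (suc r) (prodSub K F U) (t ℕ.+ d)
    prodSub-suc-HasDim = C , record { inW = C∈ ; spans = C-spans ; indep = C-indep }

  prodSub-HasDim : ∀ {t} r (U : Fin r → SubsetK K F) → (∀ i → IsSubspace (U i)) → (∀ i → HasDim (U i) t) →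
    LV.HasDim K F r (prodSub K F U) (r * t)
  prodSub-HasDim zero    U sub dims =
    (λ ()) , record { inW = λ () ; spans = λ _ _ → (λ ()) , (λ ()) , (λ ()) ; indep = λ _ _ _ () }
  prodSub-HasDim (suc r) U sub dims with dims zero | prodSub-HasDim r (U ∘ suc) (sub ∘ suc) (dims ∘ suc)
  ... | _ , isB | _ , isB′ = prodSub-suc-HasDim sub isB isB′

  e-diag : ∀ {r} (i : Fin r) → e K F i i ≡ 1#
  e-diag i with i Fin.≟ i
  ... | yes _  = refl
  ... | no i≢i = ⊥-elim (i≢i refl)

  samePoint-scale : ∀ {r} {v w : Vec K F r} {c} → c ≢ 0# → (∀ j → v j ≡ c · w j) → SamePoint K F v w
  samePoint-scale {v = v} {w} {c} c≢0 v≡cw u with inverse c c≢0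
  ... | c⁻¹ , cc⁻¹≡1 =
      (λ { (λ′ , u≡) → λ′ · c , λ j → trans (u≡ j) (trans (cong (λ′ ·_) (v≡cw j)) (sym (*-assoc λ′ c (w j)))) })
    , (λ { (μ , u≡) → μ · c⁻¹ , λ j → trans (u≡ j) (w≡ μ j) })
    where
    w≡ : ∀ μ j → μ · w j ≡ (μ · c⁻¹) · v j
    w≡ μ j = begin
      μ · w j              ≡⟨ cong (μ ·_) (sym (x·y≡1⇒x·[y·z]≡z (trans (*-comm c⁻¹ c) cc⁻¹≡1) (w j))) ⟩
      μ · (c⁻¹ · (c · w j)) ≡⟨ cong (λ z → μ · (c⁻¹ · z)) (sym (v≡cw j)) ⟩
      μ · (c⁻¹ · v j)       ≡⟨ sym (*-assoc μ c⁻¹ (v j)) ⟩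
      (μ · c⁻¹) · v j       ∎

  supported⇒samePoint : ∀ {r} {v : Vec K F r} {i} → v i ≢ 0# → (∀ j → i ≢ j → v j ≡ 0#) → SamePoint K F v (e K F i)
  supported⇒samePoint {v = v} {i} vᵢ≢0 v≡0 = samePoint-scale vᵢ≢0 v≡vᵢeᵢ
    where
    v≡vᵢeᵢ : ∀ j → v j ≡ v i · e K F i j
    v≡vᵢeᵢ j with i Fin.≟ j
    ... | yes refl = sym (*-identityʳ (v i))
    ... | no i≢j   = trans (v≡0 j i≢j) (sym (zeroʳ (v i)))

  IsBasisᵛ-resp : ∀ {r d B} {W W′ : LV.Subset K F r} → (∀ w → W w → W′ w) → (∀ w → W′ w → W w) →
    LV.IsBasis K F r W d B → LV.IsBasis K F r W′ d B
  IsBasisᵛ-resp W⊆W′ W′⊆W isB = record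
    { inW   = λ s → W⊆W′ _ (LV.IsBasis.inW isB s)
    ; spans = λ w w∈ → LV.IsBasis.spans isB w (W′⊆W w w∈)
    ; indep = LV.IsBasis.indep isB
    }

  HasWeight-resp : ∀ {r} {W : LV.Subset K F r} {v w : Vec K F r} {d} →
    SamePoint K F v w → HasWeight K F W w d → HasWeight K F W v d
  HasWeight-resp v~w (B , isB) =
    B , IsBasisᵛ-resp (λ u (u∈W , u∈w) → u∈W , proj₂ (v~w u) u∈w)
                      (λ u (u∈W , u∈v) → u∈W , proj₁ (v~w u) u∈v) isB

  axis-basis : ∀ {r} {U : Fin r → SubsetK K F} → (∀ j → IsSubspace (U j)) →
    ∀ i {d b} → IsBasis (U i) d b →
    LV.IsBasis K F r (LV._∩_ K F r (prodSub K F U) (span (e K F i))) d (λ s j → b s · e K F i j)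
  axis-basis {r} {U} sub i {d} {b} isB = record { inW = inW ; spans = spans ; indep = indep }
    where
    B : Fin d → Vec K F r
    B s j = b s · e K F i j

    inW : ∀ s → LV._∩_ K F r (prodSub K F U) (span (e K F i)) (B s)
    inW s = B∈U , b s , λ j → refl
      where
      B∈U : ∀ j → U j (B s j)
      B∈U j with i Fin.≟ j
      ... | yes refl = subst (U i) (sym (*-identityʳ (b s))) (IsBasis.inW isB s)
      ... | no _     = subst (U j) (sym (zeroʳ (b s))) (IsSubspace.0∈ (sub j))

    spans : ∀ w → LV._∩_ K F r (prodSub K F U) (span (e K F i)) w →
      ∃ λ a → (∀ s → In (a s)) × (∀ j → w j ≡ LV.lincomb K F r a B j)
    spans w (w∈U , μ , w≡μeᵢ) with IsBasis.spans isB (w i) (w∈U i)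
    ... | a , a∈ , wᵢ≡ = a , a∈ , λ j → begin
      w j                      ≡⟨ w≡μeᵢ j ⟩
      μ · e K F i j            ≡⟨ cong (_· e K F i j) (sym wᵢ≡μ) ⟩
      w i · e K F i j          ≡⟨ cong (_· e K F i j) wᵢ≡ ⟩
      lincomb a b · e K F i j  ≡⟨ sym (lincomb-*ʳ a b (e K F i j)) ⟩
      lincomb a (λ s → B s j)  ≡⟨ sym (lincombᵛ-pointwise a B j) ⟩
      LV.lincomb K F r a B j   ∎
      where
      wᵢ≡μ : w i ≡ μ
      wᵢ≡μ = trans (w≡μeᵢ i) (trans (cong (μ ·_) (e-diag i)) (*-identityʳ μ))

    indep : ∀ a → (∀ s → In (a s)) → (∀ j → LV.lincomb K F r a B j ≡ 0#) → ∀ s → a s ≡ 0#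
    indep a a∈ aB≡0 = IsBasis.indep isB a a∈ (begin
      lincomb a b                 ≡⟨ sym (*-identityʳ _) ⟩
      lincomb a b · 1#            ≡⟨ cong (lincomb a b ·_) (sym (e-diag i)) ⟩
      lincomb a b · e K F i i     ≡⟨ sym (lincomb-*ʳ a b (e K F i i)) ⟩
      lincomb a (λ s → B s i)     ≡⟨ sym (lincombᵛ-pointwise a B i) ⟩
      LV.lincomb K F r a B i      ≡⟨ aB≡0 i ⟩
      0#                          ∎)

  -- All vectors of W ∩ ⟨v⟩ are multiples of v, so their i-th coordinates satisfy
  -- the same F_q-relations as the vectors themselves once vᵢ ≠ 0.
  coordinate-independent : ∀ {r d} {W : LV.Subset K F r} {v : Vec K F r} {B} i → v i ≢ 0# →
    LV.IsBasis K F r (LV._∩_ K F r W (span v)) d B → Independent (λ s → B s i)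
  coordinate-independent {r} {v = v} {B} i vᵢ≢0 isB a a∈ aBᵢ≡0 = LV.IsBasis.indep isB a a∈ aB≡0
    where
    λ′ : ∀ s → Carrier
    λ′ s = proj₁ (proj₂ (LV.IsBasis.inW isB s))
    aB≡aλv : ∀ j → LV.lincomb K F r a B j ≡ lincomb a λ′ · v j
    aB≡aλv j = begin
      LV.lincomb K F r a B j          ≡⟨ lincombᵛ-pointwise a B j ⟩
      lincomb a (λ s → B s j)         ≡⟨ lincomb-termwise (λ s → cong (a s ·_) (proj₂ (proj₂ (LV.IsBasis.inW isB s)) j)) ⟩
      lincomb a (λ s → λ′ s · v j)    ≡⟨ lincomb-*ʳ a λ′ (v j) ⟩
      lincomb a λ′ · v j              ∎
    aλ≡0 : lincomb a λ′ ≡ 0#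
    aλ≡0 = x·y≡0⇒x≡0 vᵢ≢0 (trans (sym (aB≡aλv i)) (trans (lincombᵛ-pointwise a B i) aBᵢ≡0))
    aB≡0 : ∀ j → LV.lincomb K F r a B j ≡ 0#
    aB≡0 j = trans (aB≡aλv j) (trans (cong (_· v j) aλ≡0) (zeroˡ (v j)))

  module WeightsOfMultiSidon {r n} {U : Fin r → SubsetK K F} (ms : IsMultiSidon K F r n U) where
    open IsMultiSidon ms

    axis⇒heavy : ∀ {v : Vec K F r} {i} → SamePoint K F v (e K F i) →
      ∃ λ d → HasWeight K F (prodSub K F U) v d × 1 < d
    axis⇒heavy {i = i} v~eᵢ with dim≥2 i
    ... | d , (b , isB) , 2≤d = d , HasWeight-resp v~eᵢ (_ , axis-basis subspace i isB) , 2≤d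

    ∙S-decidable : ∀ {α W} → α ≢ 0# → Decidable W → Decidable (α ∙S W)
    ∙S-decidable {α} {W} α≢0 W? x with inverse α α≢0
    ... | α⁻¹ , αα⁻¹≡1 = map′ (λ w → α⁻¹ · x , w , sym (x·y≡1⇒x·[y·z]≡z αα⁻¹≡1 x))
                               (λ { (u , u∈W , x≡αu) → subst W (sym (α⁻¹x≡u x≡αu)) u∈W })
                               (W? (α⁻¹ · x))
      where
      α⁻¹x≡u : ∀ {u} → x ≡ α · u → α⁻¹ · x ≡ u
      α⁻¹x≡u {u} x≡αu = trans (cong (α⁻¹ ·_) x≡αu) (x·y≡1⇒x·[y·z]≡z (trans (*-comm α⁻¹ α) αα⁻¹≡1) u)

    not-in-orbit : ∀ {i j α} → i ≢ j → α ≢ 0# → ¬ (U i ≐ (α ∙S U j))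
    not-in-orbit {i} {j} {α} i≢j α≢0 Uᵢ≐αUⱼ = orbDisj i j i≢j 1# α 1≢0 α≢0 1Uᵢ≐αUⱼ
      where
      1Uᵢ≐αUⱼ : (1# ∙S U i) ≐ (α ∙S U j)
      1Uᵢ≐αUⱼ x = (λ { (u , u∈ , x≡1u) → proj₁ (Uᵢ≐αUⱼ x) (subst (U i) (sym (trans x≡1u (*-identityˡ u))) u∈) })
                , (λ x∈ → x , proj₂ (Uᵢ≐αUⱼ x) x∈ , sym (*-identityˡ x))

    module _ (_≟_ : DecidableEquality Carrier) where
      open WithDecidableEquality _≟_

      off-axis⇒light : ∀ {v : Vec K F r} {i j d} → i ≢ j → v i ≢ 0# → v j ≢ 0# →
        HasWeight K F (prodSub K F U) v d → d ≤ 1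
      off-axis⇒light {v} {i} {j} i≢j vᵢ≢0 vⱼ≢0 (B , isB) with inverse (v j) vⱼ≢0 | dim≥2 i | dim≥2 j
      ... | vⱼ⁻¹ , vⱼvⱼ⁻¹≡1 | _ , (bᵢ , isBᵢ) , _ | _ , (bⱼ , isBⱼ) , _ =
        let k , d≤k , S-dim = extendToBasis S? (combinations bᵢ)
                                (InSpan⇒∈combinations bᵢ ∘ IsBasis.spans isBᵢ _ ∘ proj₁)
                                (λ s → B s i) Bᵢ∈S (coordinate-independent i vᵢ≢0 isB)
        in  ≤-trans d≤k (sidon α i j (not-in-orbit i≢j α≢0) k S-dim)
        where
        α : Carrier
        α = v i · vⱼ⁻¹
        α≢0 : α ≢ 0#
        α≢0 = x≢0∧y≢0⇒x·y≢0 vᵢ≢0 (x·y≡1⇒y≢0 vⱼvⱼ⁻¹≡1)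
        S : Carrier → Set
        S = LK._∩_ K F (U i) (α ∙S U j)
        S? : Decidable S
        S? x = subspace-decidable (subspace i) isBᵢ x ×-dec ∙S-decidable α≢0 (subspace-decidable (subspace j) isBⱼ) x
        rescale : ∀ λ′ → λ′ · v i ≡ α · (λ′ · v j)
        rescale λ′ = sym (begin
          (v i · vⱼ⁻¹) · (λ′ · v j)   ≡⟨ *-assoc (v i) vⱼ⁻¹ (λ′ · v j) ⟩
          v i · (vⱼ⁻¹ · (λ′ · v j))   ≡⟨ cong (λ z → v i · (vⱼ⁻¹ · z)) (*-comm λ′ (v j)) ⟩
          v i · (vⱼ⁻¹ · (v j · λ′))   ≡⟨ cong (v i ·_) (x·y≡1⇒x·[y·z]≡z (trans (*-comm vⱼ⁻¹ (v j)) vⱼvⱼ⁻¹≡1) λ′) ⟩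
          v i · λ′                    ≡⟨ *-comm (v i) λ′ ⟩
          λ′ · v i                    ∎)
        Bᵢ∈S : ∀ s → S (B s i)
        Bᵢ∈S s with LV.IsBasis.inW isB s
        ... | B∈U , λ′ , B≡λ′v =
          B∈U i , B s j , B∈U j , trans (B≡λ′v i) (trans (rescale λ′) (cong (α ·_) (sym (B≡λ′v j))))

      heavy⇒axis : ∀ {v : Vec K F r} {d} → NonZeroVec K F v →
        HasWeight K F (prodSub K F U) v d → 1 < d → ∃ λ i → SamePoint K F v (e K F i)
      heavy⇒axis {v} v≢0 hw 1<d with ¬∀⟶∃¬ r (λ i → v i ≡ 0#) (λ i → v i ≟ 0#) v≢0
      ... | i , vᵢ≢0 with any? (λ j → ¬? (i Fin.≟ j) ×-dec ¬? (v j ≟ 0#))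
      ...   | yes (j , i≢j , vⱼ≢0) = ⊥-elim (<⇒≱ 1<d (off-axis⇒light i≢j vᵢ≢0 vⱼ≢0 hw))
      ...   | no no-other = i , supported⇒samePoint vᵢ≢0
                                  (λ j i≢j → decidable-stable (v j ≟ 0#) (λ vⱼ≢0 → no-other (j , i≢j , vⱼ≢0)))

corollary7p7 :
    (K : Field) (q : ℕ) (F : FiniteSubfield K q) (t r : ℕ) → 1 ≤ t → 1 ≤ r →
    (n : ℕ) → n ≡ 2 * t →
    LK.HasDim K F (λ _ → ⊤) n →
    (U : Fin r → SubsetK K F) →
    (∀ i → LK.IsSubspace K F (U i)) →
    (∀ i → LK.HasDim K F (U i) t) →
    IsMultiSidon K F r n U →
    LV.HasDim K F r (prodSub K F U) (r * t)
    × (∀ (v : Vec K F r) → NonZeroVec K F v →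
         ((∃ λ d → HasWeight K F (prodSub K F U) v d × 1 < d)
           ⇔ (∃ λ i → SamePoint K F v (e K F i))))
corollary7p7 K q F t r _ _ n _ K-dim U sub dims ms =
  prodSub-HasDim K F r U sub dims ,
  λ v v≢0 → mk⇔ (λ (d , hw , 1<d) → heavy⇒axis _≟_ v≢0 hw 1<d) (λ (i , v~eᵢ) → axis⇒heavy {i = i} v~eᵢ)
  where
  open WeightsOfMultiSidon K F ms
  _≟_ : DecidableEquality (Field.Carrier K)
  _≟_ = finiteDegree⇒decEq K F K-dim
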